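{- Let $[5,00,11]$ be the two-vertex Boolean network $f_1=x_2$, $f_2=x_1$. Among the MBNs built on $[5,00,11]$ with delay vector $(\alpha,\beta)$, the only one admitting a limit cycle is the one with $\alpha=\beta=1$ (i.e. the Boolean network itself under parallel update). Every MBN built on $[5,00,11]$ with $(\alpha,\beta)\neq(1,1)$ has exactly two attractors, the fixed points $(0,0)$ and $(\alpha,\beta)$.
   Context: The MBN built on a two-vertex Boolean network $(f_1,f_2)$ with delay vector $(\alpha,\beta)$ of positive integers has configurations $(\rho,\gamma)$ with $0\le\rho\le\alpha$, $0\le\gamma\le\beta$, underlying Boolean state $x=([\rho\ge1],[\gamma\ge1])$, and dynamics: the first coordinate becomes $\alpha$ if $f_1(x)=1$, else $\max(\rho-1,0)$; the second becomes $\beta$ if $f_2(x)=1$, else $\max(\gamma-1,0)$. Attractors are periodic orbits: fixed points (length 1) and limit cycles (length $\ge2$). -}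

module Defs where

open import Data.Bool using (Bool; true; false; if_then_else_)
open import Data.Nat using (ℕ; zero; suc; _∸_; _≤_)
open import Data.Product using (_×_; _,_; Σ; ∃)
open import Relation.Binary.PropositionalEquality using (_≡_)
open import Relation.Nullary using (¬_)

record BN₂ : Set where
  field
    f₁ : Bool → Bool → Bool
    f₂ : Bool → Bool → Bool

net5 : BN₂
net5 = record { f₁ = λ x₁ x₂ → x₂ ; f₂ = λ x₁ x₂ → x₁ }

ind : ℕ → Bool
ind zero    = false
ind (suc _) = true

Config : Set
Config = ℕ × ℕ

Valid : ℕ → ℕ → Config → Set
Valid α β (ρ , γ) = ρ ≤ α × γ ≤ β

-- one step of the MBN built on N with delay vector (α , β);
-- ρ ∸ 1 is max(ρ - 1, 0).
step : BN₂ → ℕ → ℕ → Config → Config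
step N α β (ρ , γ) =
  ( (if BN₂.f₁ N (ind ρ) (ind γ) then α else ρ ∸ 1)
  , (if BN₂.f₂ N (ind ρ) (ind γ) then β else γ ∸ 1) )

iter : ℕ → (Config → Config) → Config → Config
iter zero    F c = c
iter (suc n) F c = F (iter n F c)

Periodic : BN₂ → ℕ → ℕ → Config → Set
Periodic N α β c = Σ ℕ λ p → 1 ≤ p × iter p (step N α β) c ≡ c

IsFixed : BN₂ → ℕ → ℕ → Config → Set
IsFixed N α β c = step N α β c ≡ c

HasLimitCycle : BN₂ → ℕ → ℕ → Set
HasLimitCycle N α β =
  Σ Config λ c → Valid α β c × Periodic N α β c × ¬ IsFixed N α β c

{-# OPTIONS --safe #-}
-- Each coordinate is reset to its delay as soon as the other vertex is active,
-- so from any configuration other than (0 , 0) both counters are full after at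
-- most four steps unless α = β = 1, in which case (1 , 0) and (0 , 1) swap forever.
-- A periodic point whose orbit reaches a fixed point must be that fixed point,
-- so (0 , 0) and (α , β) are then the only periodic configurations.
module Submission where

open import Defs
open import Data.Nat using (ℕ; zero; suc; _+_; _*_; _≤_; _≟_; s≤s; z≤n)
open import Data.Nat.Properties using (*-suc; +-comm)
open import Data.Product using (_×_; _,_)
open import Data.Product.Properties using (≡-dec)
open import Data.Sum using (_⊎_; inj₁; inj₂)
open import Data.Empty using (⊥-elim)
open import Function.Bundles using (_⇔_; mk⇔; Equivalence)
open import Relation.Binary.PropositionalEquality
  using (_≡_; _≢_; refl; cong; sym; trans; module ≡-Reasoning)
open import Relation.Nullary using (¬_; Dec; yes; no)
open import Relation.Nullary.Decidable using (_×-dec_)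

module _ {G : Config → Config} where

  iter-+ : ∀ m n c → iter (m + n) G c ≡ iter m G (iter n G c)
  iter-+ zero    n c = refl
  iter-+ (suc m) n c = cong G (iter-+ m n c)

  iter-fixed : ∀ {d} → G d ≡ d → ∀ n → iter n G d ≡ d
  iter-fixed Gd≡d zero    = refl
  iter-fixed Gd≡d (suc n) = trans (cong G (iter-fixed Gd≡d n)) Gd≡d

  iter-*-periodic : ∀ {c} p → iter p G c ≡ c → ∀ k → iter (k * p) G c ≡ c
  iter-*-periodic p per zero    = refl
  iter-*-periodic p per (suc k) =
    trans (iter-+ p (k * p) _) (trans (cong (iter p G) (iter-*-periodic p per k)) per)

  -- Running n periods returns to c, but also passes through iter n G c = d.
  periodic-reaching-fixed : ∀ {c d p} n → 1 ≤ p → iter p G c ≡ c →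
    G d ≡ d → iter n G c ≡ d → c ≡ d
  periodic-reaching-fixed {c} {d} {suc q} n _ per Gd≡d reach = begin
    c                           ≡⟨ sym (iter-*-periodic (suc q) per n) ⟩
    iter (n * suc q) G c        ≡⟨ cong (λ m → iter m G c) (trans (*-suc n q) (+-comm n (n * q))) ⟩
    iter (n * q + n) G c        ≡⟨ iter-+ (n * q) n c ⟩
    iter (n * q) G (iter n G c) ≡⟨ cong (iter (n * q) G) reach ⟩
    iter (n * q) G d            ≡⟨ iter-fixed Gd≡d (n * q) ⟩
    d                           ∎
    where open ≡-Reasoning

UnitDelays : ℕ → ℕ → Set
UnitDelays α β = α ≡ 1 × β ≡ 1

unitDelays? : ∀ α β → Dec (UnitDelays α β)
unitDelays? α β = (α ≟ 1) ×-dec (β ≟ 1)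

origin-fixed : ∀ α β → IsFixed net5 α β (0 , 0)
origin-fixed α β = refl

top-fixed : ∀ a b → IsFixed net5 (suc a) (suc b) (suc a , suc b)
top-fixed a b = refl

iter4-reaches-top : ∀ a b → ¬ UnitDelays (suc a) (suc b) → ∀ c → c ≢ (0 , 0) →
  iter 4 (step net5 (suc a) (suc b)) c ≡ (suc a , suc b)
iter4-reaches-top a       b       _ (zero , zero)          c≢0 = ⊥-elim (c≢0 refl)
iter4-reaches-top a       b       _ (suc r , suc g)        _   = refl
iter4-reaches-top a       b       _ (suc (suc r) , zero)   _   = refl
iter4-reaches-top a       b       _ (zero , suc (suc g))   _   = refl
iter4-reaches-top zero    zero    ¬t (suc zero , zero)     _   = ⊥-elim (¬t (refl , refl))
iter4-reaches-top zero    (suc b) _ (suc zero , zero)      _   = refl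
iter4-reaches-top (suc a) zero    _ (suc zero , zero)      _   = refl
iter4-reaches-top (suc a) (suc b) _ (suc zero , zero)      _   = refl
iter4-reaches-top zero    zero    ¬t (zero , suc zero)     _   = ⊥-elim (¬t (refl , refl))
iter4-reaches-top zero    (suc b) _ (zero , suc zero)      _   = refl
iter4-reaches-top (suc a) zero    _ (zero , suc zero)      _   = refl
iter4-reaches-top (suc a) (suc b) _ (zero , suc zero)      _   = refl

periodic⇔origin-or-top : ∀ a b → ¬ UnitDelays (suc a) (suc b) → ∀ c →
  Periodic net5 (suc a) (suc b) c ⇔ (c ≡ (0 , 0) ⊎ c ≡ (suc a , suc b))
periodic⇔origin-or-top a b ¬t c = mk⇔ to from
  where
  to : Periodic net5 (suc a) (suc b) c → c ≡ (0 , 0) ⊎ c ≡ (suc a , suc b)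
  to (p , 1≤p , per) with ≡-dec _≟_ _≟_ c (0 , 0)
  ... | yes c≡0 = inj₁ c≡0
  ... | no  c≢0 = inj₂ (periodic-reaching-fixed 4 1≤p per (top-fixed a b)
                          (iter4-reaches-top a b ¬t c c≢0))

  from : c ≡ (0 , 0) ⊎ c ≡ (suc a , suc b) → Periodic net5 (suc a) (suc b) c
  from (inj₁ refl) = 1 , s≤s z≤n , refl
  from (inj₂ refl) = 1 , s≤s z≤n , refl

limitCycle⇒unitDelays : ∀ a b → HasLimitCycle net5 (suc a) (suc b) → UnitDelays (suc a) (suc b)
limitCycle⇒unitDelays a b (c , _ , per , ¬fixed) with unitDelays? (suc a) (suc b)
... | yes t  = t
... | no  ¬t with Equivalence.to (periodic⇔origin-or-top a b ¬t c) per
...   | inj₁ refl = ⊥-elim (¬fixed (origin-fixed (suc a) (suc b)))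
...   | inj₂ refl = ⊥-elim (¬fixed (top-fixed a b))

unitDelays⇒limitCycle : ∀ {α β} → UnitDelays α β → HasLimitCycle net5 α β
unitDelays⇒limitCycle (refl , refl) = (1 , 0) , (s≤s z≤n , z≤n) , (2 , s≤s z≤n , refl) , λ ()

proposition13 : (α β : ℕ) → 1 ≤ α → 1 ≤ β →
    (HasLimitCycle net5 α β ⇔ (α ≡ 1 × β ≡ 1))
    × (¬ (α ≡ 1 × β ≡ 1) →
        ((c : Config) → Valid α β c →
           (Periodic net5 α β c ⇔ (c ≡ (0 , 0) ⊎ c ≡ (α , β))))
        × IsFixed net5 α β (0 , 0)
        × IsFixed net5 α β (α , β))
proposition13 (suc a) (suc b) _ _ =
  mk⇔ (limitCycle⇒unitDelays a b) unitDelays⇒limitCycle ,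
  λ ¬t → (λ c _ → periodic⇔origin-or-top a b ¬t c)
       , origin-fixed (suc a) (suc b)
       , top-fixed a b
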